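{- Let $a,b\in Ag$ with $a\neq b$. Then for all $\varphi,\psi\in\mathrm{Fm}_{\mathsf S}$: (1) $\vdash_{\mathsf S}S_{a,b}(\varphi\lor\psi)\land K_a\varphi\land I_a\varphi\to S_{a,b}\varphi$; (2) $\vdash_{\mathsf S}S_{a,b}(\varphi\lor\psi)\land S_{a,b}(\neg\varphi)\to S_{a,b}\psi$; and moreover there exist formulas $\varphi,\psi$ such that (3) $\not\vdash_{\mathsf S}S_{a,b}(\varphi\lor\psi)\to S_{a,b}\varphi\lor S_{a,b}\psi$, and there exist formulas $\varphi,\psi$ such that (4) $\not\vdash_{\mathsf S}S_{a,b}\varphi\lor S_{a,b}\psi\to S_{a,b}(\varphi\lor\psi)$.
   Context: Let $Ag$ be a non-empty finite set of agents (with at least two elements) and $Var$ a countably infinite set of propositional variables. The formulas $\mathrm{Fm}_{\mathsf S}$ are generated by $\varphi::=p\mid\neg\varphi\mid\varphi\land\varphi\mid I_a\varphi\mid K_a\varphi\mid B_a\varphi$ ($p\in Var$, $a\in Ag$), with $\lor,\to$ classical abbreviations. The logic $\mathsf S$ ($\vdash_{\mathsf S}\varphi$ means $\varphi$ is derivable) has as axioms: all classical tautologies; for each $a$ and $\star\in\{K_a,B_a,I_a\}$, $\star(\varphi\to\psi)\to(\star\varphi\to\star\psi)$; $K_a\varphi\to\varphi$; $K_a\varphi\to K_aK_a\varphi$; $B_a\varphi\to\neg B_a\neg\varphi$; $K_a\varphi\to B_a\varphi$; $B_a\varphi\to K_aB_a\varphi$; $I_a\varphi\to\neg I_a\neg\varphi$;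 $I_a\varphi\to K_aI_a\varphi$; $I_a\varphi\to I_aK_a\varphi$; $I_a\varphi\to I_aI_a\varphi$; rules: modus ponens and necessitation for each $K_a,B_a,I_a$. $S_{a,b}\varphi:=K_a\varphi\land B_a\neg K_b\varphi\land I_a(\varphi\land\neg K_b\varphi)$. -}

module Defs where

open import Data.Nat using (ℕ; suc)
open import Data.Fin using (Fin)
open import Data.Bool using (Bool; true; false; not; _∧_)
open import Data.Sum using (_⊎_)
open import Data.Product using (_×_)
open import Relation.Binary.PropositionalEquality using (_≡_)

module Syntax (n : ℕ) where

  Ag : Set
  Ag = Fin n

  infix 9 ¬'_
  infixr 6 _∧'_
  infixr 5 _∨'_
  infixr 4 _⇒_
  infix 2 ⊢_
  data Fm : Set where
    var  : ℕ → Fm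
    ¬'_  : Fm → Fm
    _∧'_ : Fm → Fm → Fm
    I    : Ag → Fm → Fm
    K    : Ag → Fm → Fm
    B    : Ag → Fm → Fm

  _∨'_ : Fm → Fm → Fm
  φ ∨' ψ = ¬' (¬' φ ∧' ¬' ψ)

  _⇒_ : Fm → Fm → Fm
  φ ⇒ ψ = ¬' (φ ∧' ¬' ψ)

  eval : (Fm → Bool) → Fm → Bool
  eval v (var p)   = v (var p)
  eval v (¬' φ)    = not (eval v φ)
  eval v (φ ∧' ψ)  = eval v φ ∧ eval v ψ
  eval v (I a φ)   = v (I a φ)
  eval v (K a φ)   = v (K a φ)
  eval v (B a φ)   = v (B a φ)

  Tautology : Fm → Set
  Tautology φ = (v : Fm → Bool) → eval v φ ≡ true

  data ⊢_ : Fm → Set where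
    taut   : ∀ {φ} → Tautology φ → ⊢ φ
    K-I    : ∀ a φ ψ → ⊢ (I a (φ ⇒ ψ) ⇒ (I a φ ⇒ I a ψ))
    K-K    : ∀ a φ ψ → ⊢ (K a (φ ⇒ ψ) ⇒ (K a φ ⇒ K a ψ))
    K-B    : ∀ a φ ψ → ⊢ (B a (φ ⇒ ψ) ⇒ (B a φ ⇒ B a ψ))
    T-K    : ∀ a φ → ⊢ (K a φ ⇒ φ)
    4-K    : ∀ a φ → ⊢ (K a φ ⇒ K a (K a φ))
    D-B    : ∀ a φ → ⊢ (B a φ ⇒ ¬' B a (¬' φ))
    KB     : ∀ a φ → ⊢ (K a φ ⇒ B a φ)
    BKB    : ∀ a φ → ⊢ (B a φ ⇒ K a (B a φ))
    D-I    : ∀ a φ → ⊢ (I a φ ⇒ ¬' I a (¬' φ))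
    IKI    : ∀ a φ → ⊢ (I a φ ⇒ K a (I a φ))
    IIK    : ∀ a φ → ⊢ (I a φ ⇒ I a (K a φ))
    III    : ∀ a φ → ⊢ (I a φ ⇒ I a (I a φ))
    mp     : ∀ {φ ψ} → ⊢ (φ ⇒ ψ) → ⊢ φ → ⊢ ψ
    nec-K  : ∀ {φ} a → ⊢ φ → ⊢ K a φ
    nec-B  : ∀ {φ} a → ⊢ φ → ⊢ B a φ
    nec-I  : ∀ {φ} a → ⊢ φ → ⊢ I a φ

  S : Ag → Ag → Fm → Fm
  S a b φ = K a φ ∧' (B a (¬' K b φ) ∧' I a (φ ∧' ¬' K b φ))

{-# OPTIONS --safe #-}
module Submission where

-- For (1) and (2)
-- each conjunct of the conclusion follows from the matching conjuncts of the premises by a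
-- propositional consequence (disjunctive syllogism, antitonicity of ¬K_b) pushed through the
-- normal modalities K_a, B_a and I_a. For (3) and (4) take three worlds with p true only at
-- world 0 and q only at world 1, let a confuse worlds 0 and 1, and let b confuse all worlds.
-- At world 0, S_{a,b}(p ∨ q) holds although a knows neither p nor q, and S_{a,b} fails for the
-- tautology (p ∨ q) ∨ ¬(p ∨ q), which b knows.

open import Defs
open import Data.Bool using (Bool; true; false; not; _∧_; T)
import Data.Bool.Properties as Bool
open import Data.Fin using (Fin; zero; suc; toℕ)
open import Data.Fin.Properties using (all?; _≟_)
open import Data.Nat using (ℕ; suc; _≡ᵇ_)
open import Data.Product using (_×_; _,_; ∃₂)
open import Data.Vec using (Vec; []; _∷_; lookup; map)
open import Data.Vec.Properties using (lookup-map)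
open import Function using (_∘_; id)
open import Function.Bundles using (Equivalence)
open import Relation.Binary.Definitions using (DecidableEquality)
open import Relation.Binary.PropositionalEquality
  using (_≡_; _≢_; refl; sym; trans; cong; cong₂; subst)
open import Relation.Nullary using (¬_; Dec; does)
open import Relation.Nullary.Decidable
  using (⌊_⌋; True; toWitness; fromWitness; map′; T?; _×-dec_; _→-dec_; dec-true; dec-false)

infixr 4 _⇒ᵇ_

-- Agda cannot invert `not` and `_∧_`, so the antecedent of `x ⇒ᵇ y` in the two lemmas below
-- must usually be supplied explicitly.

_⇒ᵇ_ : Bool → Bool → Bool
x ⇒ᵇ y = not (x ∧ not y)

T-⇒ᵇ-intro : ∀ {x y} → (T x → T y) → T (x ⇒ᵇ y)
T-⇒ᵇ-intro {false}         _ = _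
T-⇒ᵇ-intro {true} {true}   _ = _
T-⇒ᵇ-intro {true} {false}  f = f _

T-⇒ᵇ-elim : ∀ {x y} → T (x ⇒ᵇ y) → T x → T y
T-⇒ᵇ-elim {true} {true} _ _ = _

T-not-intro : ∀ {x} → ¬ T x → T (not x)
T-not-intro {false} _  = _
T-not-intro {true}  ¬x = ¬x _

T-not-elim : ∀ {x} → T (not x) → ¬ T x
T-not-elim {true} ()

all-valuations? : ∀ {k} {P : Vec Bool k → Set} → (∀ ρ → Dec (P ρ)) → Dec (∀ ρ → P ρ)
all-valuations? {0} P? = map′ (λ { p [] → p }) (λ p → p []) (P? [])
all-valuations? {suc k} {P} P? =
  map′ join (λ p → p ∘ (true ∷_) , p ∘ (false ∷_))
       (all-valuations? (P? ∘ (true ∷_)) ×-dec all-valuations? (P? ∘ (false ∷_)))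
  where
  join : (∀ ρ → P (true ∷ ρ)) × (∀ ρ → P (false ∷ ρ)) → ∀ ρ → P ρ
  join (p , _) (true  ∷ ρ) = p ρ
  join (_ , p) (false ∷ ρ) = p ρ

infix  9 ¬ₛ_
infixr 6 _∧ₛ_
infixr 5 _∨ₛ_
infixr 4 _⇒ₛ_

data Schema (k : ℕ) : Set where
  atom : Fin k → Schema k
  ¬ₛ_  : Schema k → Schema k
  _∧ₛ_ : Schema k → Schema k → Schema k

_∨ₛ_ _⇒ₛ_ : ∀ {k} → Schema k → Schema k → Schema k
P ∨ₛ Q = ¬ₛ (¬ₛ P ∧ₛ ¬ₛ Q)
P ⇒ₛ Q = ¬ₛ (P ∧ₛ ¬ₛ Q)

pattern A₀ = atom zero
pattern A₁ = atom (suc zero)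
pattern A₂ = atom (suc (suc zero))

⟦_⟧ₛ : ∀ {k} → Schema k → Vec Bool k → Bool
⟦ atom i ⟧ₛ  ρ = lookup ρ i
⟦ ¬ₛ P ⟧ₛ    ρ = not (⟦ P ⟧ₛ ρ)
⟦ P ∧ₛ Q ⟧ₛ  ρ = ⟦ P ⟧ₛ ρ ∧ ⟦ Q ⟧ₛ ρ

valid? : ∀ {k} (P : Schema k) → Dec (∀ ρ → T (⟦ P ⟧ₛ ρ))
valid? P = all-valuations? (T? ∘ ⟦ P ⟧ₛ)

module _ {W O : Set} (_≟ₒ_ : DecidableEquality O) (view : W → O) where

  kernel : W → W → Bool
  kernel w v = ⌊ view w ≟ₒ view v ⌋

  kernel-reflexive : ∀ w → T (kernel w w)
  kernel-reflexive _ = fromWitness refl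

  kernel-transitive : ∀ {u v w} → T (kernel u v) → T (kernel v w) → T (kernel u w)
  kernel-transitive r s = fromWitness (trans (toWitness r) (toWitness s))

module _ {n : ℕ} where
  open Syntax n

  _⟨_⟩ : ∀ {k} → Schema k → Vec Fm k → Fm
  atom i   ⟨ σ ⟩ = lookup σ i
  (¬ₛ P)   ⟨ σ ⟩ = ¬' (P ⟨ σ ⟩)
  (P ∧ₛ Q) ⟨ σ ⟩ = P ⟨ σ ⟩ ∧' Q ⟨ σ ⟩

  eval-⟨⟩ : ∀ {k} v (P : Schema k) σ → eval v (P ⟨ σ ⟩) ≡ ⟦ P ⟧ₛ (map (eval v) σ)
  eval-⟨⟩ v (atom i) σ = sym (lookup-map i (eval v) σ)
  eval-⟨⟩ v (¬ₛ P)   σ = cong not (eval-⟨⟩ v P σ)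
  eval-⟨⟩ v (P ∧ₛ Q) σ = cong₂ _∧_ (eval-⟨⟩ v P σ) (eval-⟨⟩ v Q σ)

  -- For a closed schema `True (valid? P)` evaluates to ⊤, so the truth table is checked by
  -- normalisation and the implicit argument is solved automatically.
  tautology : ∀ {k} (P : Schema k) {_ : True (valid? P)} (σ : Vec Fm k) → ⊢ P ⟨ σ ⟩
  tautology P {valid} σ =
    taut λ v → trans (eval-⟨⟩ v P σ) (Equivalence.to Bool.T-≡ (toWitness valid (map (eval v) σ)))

  infixr 3 _⨾_

  _⨾_ : ∀ {X Y Z} → ⊢ X ⇒ Y → ⊢ Y ⇒ Z → ⊢ X ⇒ Z
  _⨾_ {X} {Y} {Z} p q =
    mp (mp (tautology ((A₀ ⇒ₛ A₁) ⇒ₛ (A₁ ⇒ₛ A₂) ⇒ₛ A₀ ⇒ₛ A₂) (X ∷ Y ∷ Z ∷ [])) p) q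

  ∧-intro : ∀ {H X Y} → ⊢ H ⇒ X → ⊢ H ⇒ Y → ⊢ H ⇒ X ∧' Y
  ∧-intro {H} {X} {Y} p q =
    mp (mp (tautology ((A₀ ⇒ₛ A₁) ⇒ₛ (A₀ ⇒ₛ A₂) ⇒ₛ A₀ ⇒ₛ A₁ ∧ₛ A₂) (H ∷ X ∷ Y ∷ [])) p) q

  ∧-elimˡ : ∀ {X Y} → ⊢ X ∧' Y ⇒ X
  ∧-elimˡ {X} {Y} = tautology (A₀ ∧ₛ A₁ ⇒ₛ A₀) (X ∷ Y ∷ [])

  ∧-elimʳ : ∀ {X Y} → ⊢ X ∧' Y ⇒ Y
  ∧-elimʳ {X} {Y} = tautology (A₀ ∧ₛ A₁ ⇒ₛ A₁) (X ∷ Y ∷ [])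

  ∧-map : ∀ {X X′ Y Y′} → ⊢ X ⇒ X′ → ⊢ Y ⇒ Y′ → ⊢ X ∧' Y ⇒ X′ ∧' Y′
  ∧-map p q = ∧-intro (∧-elimˡ ⨾ p) (∧-elimʳ ⨾ q)

  contrapose : ∀ {X Y} → ⊢ X ⇒ Y → ⊢ ¬' Y ⇒ ¬' X
  contrapose {X} {Y} = mp (tautology ((A₀ ⇒ₛ A₁) ⇒ₛ ¬ₛ A₁ ⇒ₛ ¬ₛ A₀) (X ∷ Y ∷ []))

  ∨-introˡ : ∀ {X Y} → ⊢ X ⇒ X ∨' Y
  ∨-introˡ {X} {Y} = tautology (A₀ ⇒ₛ A₀ ∨ₛ A₁) (X ∷ Y ∷ [])

  ∨-introʳ : ∀ {X Y} → ⊢ Y ⇒ X ∨' Y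
  ∨-introʳ {X} {Y} = tautology (A₁ ⇒ₛ A₀ ∨ₛ A₁) (X ∷ Y ∷ [])

  ∨-syllogism : ∀ {X Y} → ⊢ (X ∨' Y) ∧' ¬' X ⇒ Y
  ∨-syllogism {X} {Y} = tautology ((A₀ ∨ₛ A₁) ∧ₛ ¬ₛ A₀ ⇒ₛ A₁) (X ∷ Y ∷ [])

  curry : ∀ {X Y Z} → ⊢ X ∧' Y ⇒ Z → ⊢ X ⇒ Y ⇒ Z
  curry {X} {Y} {Z} = mp (tautology ((A₀ ∧ₛ A₁ ⇒ₛ A₂) ⇒ₛ A₀ ⇒ₛ A₁ ⇒ₛ A₂) (X ∷ Y ∷ Z ∷ []))

  uncurry : ∀ {X Y Z} → ⊢ X ⇒ Y ⇒ Z → ⊢ X ∧' Y ⇒ Z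
  uncurry {X} {Y} {Z} = mp (tautology ((A₀ ⇒ₛ A₁ ⇒ₛ A₂) ⇒ₛ A₀ ∧ₛ A₁ ⇒ₛ A₂) (X ∷ Y ∷ Z ∷ []))

  record NormalModality : Set where
    field
      □             : Fm → Fm
      distrib       : ∀ φ ψ → ⊢ □ (φ ⇒ ψ) ⇒ □ φ ⇒ □ ψ
      necessitation : ∀ {φ} → ⊢ φ → ⊢ □ φ

  knowledge belief intention : Ag → NormalModality
  knowledge c = record { □ = K c ; distrib = K-K c ; necessitation = nec-K c }
  belief    c = record { □ = B c ; distrib = K-B c ; necessitation = nec-B c }
  intention c = record { □ = I c ; distrib = K-I c ; necessitation = nec-I c }

  module _ (M : NormalModality) where
    open NormalModality M

    □-mono : ∀ {X Y} → ⊢ X ⇒ Y → ⊢ □ X ⇒ □ Y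
    □-mono p = mp (distrib _ _) (necessitation p)

    □-∧-mono : ∀ {X Y Z} → ⊢ X ∧' Y ⇒ Z → ⊢ □ X ∧' □ Y ⇒ □ Z
    □-∧-mono p = uncurry (□-mono (curry p) ⨾ distrib _ _)

  ¬K-antitone : ∀ {c X Y} → ⊢ X ⇒ Y → ⊢ ¬' K c Y ⇒ ¬' K c X
  ¬K-antitone {c} p = contrapose (□-mono (knowledge c) p)

  Ignorant : Ag → Fm → Fm
  Ignorant b χ = χ ∧' ¬' K b χ

  ignorant-∨ˡ : ∀ {b φ ψ} → ⊢ Ignorant b (φ ∨' ψ) ∧' φ ⇒ Ignorant b φ
  ignorant-∨ˡ = ∧-intro ∧-elimʳ (∧-elimˡ ⨾ ∧-elimʳ ⨾ ¬K-antitone ∨-introˡ)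

  ignorant-syllogism : ∀ {b φ ψ} → ⊢ Ignorant b (φ ∨' ψ) ∧' Ignorant b (¬' φ) ⇒ Ignorant b ψ
  ignorant-syllogism =
    ∧-intro (∧-map ∧-elimˡ ∧-elimˡ ⨾ ∨-syllogism) (∧-elimˡ ⨾ ∧-elimʳ ⨾ ¬K-antitone ∨-introʳ)

  module _ {a b : Ag} where

    S-intro : ∀ {H χ} → ⊢ H ⇒ K a χ → ⊢ H ⇒ B a (¬' K b χ) → ⊢ H ⇒ I a (Ignorant b χ) →
              ⊢ H ⇒ S a b χ
    S-intro k β ι = ∧-intro k (∧-intro β ι)

    S-K : ∀ {χ} → ⊢ S a b χ ⇒ K a χ
    S-K = ∧-elimˡ

    S-B : ∀ {χ} → ⊢ S a b χ ⇒ B a (¬' K b χ)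
    S-B = ∧-elimʳ ⨾ ∧-elimˡ

    S-I : ∀ {χ} → ⊢ S a b χ ⇒ I a (Ignorant b χ)
    S-I = ∧-elimʳ ⨾ ∧-elimʳ

  S-∨-known-disjunct : ∀ a b φ ψ → ⊢ S a b (φ ∨' ψ) ∧' (K a φ ∧' I a φ) ⇒ S a b φ
  S-∨-known-disjunct a b φ ψ = S-intro
    (∧-elimʳ ⨾ ∧-elimˡ)
    (∧-elimˡ ⨾ S-B ⨾ □-mono (belief a) (¬K-antitone ∨-introˡ))
    (∧-map S-I ∧-elimʳ ⨾ □-∧-mono (intention a) ignorant-∨ˡ)

  S-∨-syllogism : ∀ a b φ ψ → ⊢ S a b (φ ∨' ψ) ∧' S a b (¬' φ) ⇒ S a b ψ
  S-∨-syllogism a b φ ψ = S-intro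
    (∧-map S-K S-K ⨾ □-∧-mono (knowledge a) ∨-syllogism)
    (∧-elimˡ ⨾ S-B ⨾ □-mono (belief a) (¬K-antitone ∨-introʳ))
    (∧-map S-I S-I ⨾ □-∧-mono (intention a) ignorant-syllogism)

  module Kripke {m : ℕ} (R : Ag → Fin m → Fin m → Bool) (V : ℕ → Fin m → Bool) where

    □ : Ag → (Fin m → Bool) → Fin m → Bool
    □ c X w = ⌊ all? (λ v → T? (R c w v) →-dec T? (X v)) ⌋

    -- K c, B c and I c share the relation R c. This collapses the three modalities, so every
    -- axiom of S becomes an instance of K, T, 4 or D.
    ⟦_⟧ : Fm → Fin m → Bool
    ⟦ var p ⟧   w = V p w
    ⟦ ¬' φ ⟧    w = not (⟦ φ ⟧ w)
    ⟦ φ ∧' ψ ⟧  w = ⟦ φ ⟧ w ∧ ⟦ ψ ⟧ w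
    ⟦ I c φ ⟧   w = □ c ⟦ φ ⟧ w
    ⟦ K c φ ⟧   w = □ c ⟦ φ ⟧ w
    ⟦ B c φ ⟧   w = □ c ⟦ φ ⟧ w

    eval-⟦⟧ : ∀ φ w → eval (λ χ → ⟦ χ ⟧ w) φ ≡ ⟦ φ ⟧ w
    eval-⟦⟧ (var p)  w = refl
    eval-⟦⟧ (¬' φ)   w = cong not (eval-⟦⟧ φ w)
    eval-⟦⟧ (φ ∧' ψ) w = cong₂ _∧_ (eval-⟦⟧ φ w) (eval-⟦⟧ ψ w)
    eval-⟦⟧ (I c φ)  w = refl
    eval-⟦⟧ (K c φ)  w = refl
    eval-⟦⟧ (B c φ)  w = refl

    □-intro : ∀ {c X w} → (∀ v → T (R c w v) → T (X v)) → T (□ c X w)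
    □-intro = fromWitness

    □-elim : ∀ {c X w} → T (□ c X w) → ∀ v → T (R c w v) → T (X v)
    □-elim = toWitness

    □-necessitation : ∀ c {X} → (∀ w → T (X w)) → ∀ w → T (□ c X w)
    □-necessitation c X-valid w = □-intro λ v _ → X-valid v

    □-distrib : ∀ c X Y w → T (□ c (λ v → X v ⇒ᵇ Y v) w ⇒ᵇ □ c X w ⇒ᵇ □ c Y w)
    □-distrib c X Y w =
      T-⇒ᵇ-intro {□ c (λ v → X v ⇒ᵇ Y v) w} λ □X⇒Y → T-⇒ᵇ-intro {□ c X w} λ □X →
        □-intro λ v r → T-⇒ᵇ-elim {X v} (□-elim □X⇒Y v r) (□-elim □X v r)

    module _ (reflexive  : ∀ c w → T (R c w w))
             (transitive : ∀ c {u v w} → T (R c u v) → T (R c v w) → T (R c u w)) where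

      □-reflexive : ∀ c X w → T (□ c X w ⇒ᵇ X w)
      □-reflexive c X w = T-⇒ᵇ-intro {□ c X w} λ □X → □-elim □X w (reflexive c w)

      □-transitive : ∀ c X w → T (□ c X w ⇒ᵇ □ c (□ c X) w)
      □-transitive c X w = T-⇒ᵇ-intro {□ c X w} λ □X →
        □-intro λ u r → □-intro λ v s → □-elim □X v (transitive c r s)

      □-consistent : ∀ c X w → T (□ c X w ⇒ᵇ not (□ c (not ∘ X) w))
      □-consistent c X w = T-⇒ᵇ-intro {□ c X w} λ □X → T-not-intro λ □¬X →
        T-not-elim (□-elim □¬X w (reflexive c w)) (□-elim □X w (reflexive c w))

      sound : ∀ {φ} → ⊢ φ → ∀ w → T (⟦ φ ⟧ w)
      sound {φ} (taut t)    w = Equivalence.from Bool.T-≡ (trans (sym (eval-⟦⟧ φ w)) (t _))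
      sound (K-I c φ ψ)     w = □-distrib c ⟦ φ ⟧ ⟦ ψ ⟧ w
      sound (K-K c φ ψ)     w = □-distrib c ⟦ φ ⟧ ⟦ ψ ⟧ w
      sound (K-B c φ ψ)     w = □-distrib c ⟦ φ ⟧ ⟦ ψ ⟧ w
      sound (T-K c φ)       w = □-reflexive c ⟦ φ ⟧ w
      sound (4-K c φ)       w = □-transitive c ⟦ φ ⟧ w
      sound (D-B c φ)       w = □-consistent c ⟦ φ ⟧ w
      sound (KB c φ)        w = T-⇒ᵇ-intro {⟦ K c φ ⟧ w} id
      sound (BKB c φ)       w = □-transitive c ⟦ φ ⟧ w
      sound (D-I c φ)       w = □-consistent c ⟦ φ ⟧ w
      sound (IKI c φ)       w = □-transitive c ⟦ φ ⟧ w
      sound (IIK c φ)       w = □-transitive c ⟦ φ ⟧ w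
      sound (III c φ)       w = □-transitive c ⟦ φ ⟧ w
      sound (mp {φ} p q)    w = T-⇒ᵇ-elim {⟦ φ ⟧ w} (sound p w) (sound q w)
      sound (nec-K c p)     w = □-necessitation c (sound p) w
      sound (nec-B c p)     w = □-necessitation c (sound p) w
      sound (nec-I c p)     w = □-necessitation c (sound p) w

      ⟦⟧-false⇒unprovable : ∀ {φ} w → ⟦ φ ⟧ w ≡ false → ¬ (⊢ φ)
      ⟦⟧-false⇒unprovable w φ-false ⊢φ = subst T φ-false (sound ⊢φ w)

  p q : Fm
  p = var 0
  q = var 1

  view : (Ag → Bool) → Ag → Fin 3 → Bool
  view observant c w = observant c ∧ (toℕ w ≡ᵇ 2)

  module Counter (observant : Ag → Bool) =
    Kripke (λ c → kernel Bool._≟_ (view observant c)) (λ i w → toℕ w ≡ᵇ i)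

  -- Keeping `observant` abstract (instead of fixing it to `does (c ≟ a)`) lets the truth value
  -- be computed once `observant a` and `observant b` are rewritten to constructors.
  Refuted : Ag → Ag → Fm → Set
  Refuted a b χ =
    ∀ observant → observant a ≡ true → observant b ≡ false → Counter.⟦_⟧ observant χ zero ≡ false

  refuted⇒unprovable : ∀ {a b χ} → a ≢ b → Refuted a b χ → ¬ (⊢ χ)
  refuted⇒unprovable {a} {b} a≢b refuted =
    Counter.⟦⟧-false⇒unprovable observant
      (λ c → kernel-reflexive Bool._≟_ (view observant c))
      (λ c {u v w} → kernel-transitive Bool._≟_ (view observant c) {u} {v} {w})
      zero
      (refuted observant (dec-true (a ≟ a) refl) (dec-false (b ≟ a) (a≢b ∘ sym)))
    where
    observant : Ag → Bool
    observant c = does (c ≟ a)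

  S-∨-split-refuted : ∀ a b → Refuted a b (S a b (p ∨' q) ⇒ (S a b p ∨' S a b q))
  S-∨-split-refuted a b _ a-observant b-blind rewrite a-observant | b-blind = refl

  S-∨-join-refuted : ∀ a b →
    Refuted a b ((S a b (p ∨' q) ∨' S a b (¬' (p ∨' q))) ⇒ S a b ((p ∨' q) ∨' ¬' (p ∨' q)))
  S-∨-join-refuted a b _ a-observant b-blind rewrite a-observant | b-blind = refl

mainTheorem14 : (n : ℕ) → let open Syntax (suc (suc n)) in
    (a b : Ag) → a ≢ b →
      ((φ ψ : Fm) → ⊢ ((S a b (φ ∨' ψ) ∧' (K a φ ∧' I a φ)) ⇒ S a b φ))
    × ((φ ψ : Fm) → ⊢ ((S a b (φ ∨' ψ) ∧' S a b (¬' φ)) ⇒ S a b ψ))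
    × (∃₂ λ φ ψ → ¬ (⊢ (S a b (φ ∨' ψ) ⇒ (S a b φ ∨' S a b ψ))))
    × (∃₂ λ φ ψ → ¬ (⊢ ((S a b φ ∨' S a b ψ) ⇒ S a b (φ ∨' ψ))))
mainTheorem14 n a b a≢b =
    S-∨-known-disjunct a b
  , S-∨-syllogism a b
  , (p , q , refuted⇒unprovable a≢b (S-∨-split-refuted a b))
  , (p ∨' q , ¬' (p ∨' q) , refuted⇒unprovable a≢b (S-∨-join-refuted a b))
  where open Syntax (suc (suc n)) using (_∨'_; ¬'_)
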